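{- Every crystallographic root system has infinitely many compatible primes.
   Context: Let $(W,S)$ be a finite Coxeter system and $\Phi\subset V=\bigoplus_{s\in S}\mathbb{R}\alpha_s$ a crystallographic root system for it with simple roots $\alpha_s$, so every root is an integer linear combination of the simple roots; $\Phi^+$ are the positive roots. Let $V_{\mathbb{Z}}=\bigoplus_{s\in S}\mathbb{Z}\alpha_s$, let $V^{(p)}$ be the $\mathbb{F}_p$-vector space with basis $\{\alpha_s^{(p)}\}$, and let $\rho^{(p)}:V_{\mathbb{Z}}\to V^{(p)}$ be reduction mod $p$ with $\alpha_s\mapsto\alpha_s^{(p)}$. A prime $p$ is compatible with $\Phi$ if for every basis $B\subseteq\Phi^+$ of $V$ the image $\rho^{(p)}(B)$ is a basis of $V^{(p)}$. -}

module Defs where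

open import Data.Nat as ℕ using (ℕ; zero; suc)
open import Data.Fin as Fin using (Fin; zero; suc)
open import Data.Integer as ℤ using (ℤ; +_)
open import Data.Integer.Divisibility using () renaming (_∣_ to _∣ℤ_)
open import Data.Rational as ℚ using (ℚ; 0ℚ)
open import Data.Vec using (Vec; lookup; tabulate)
open import Data.Vec.Relation.Unary.All using (All)
open import Data.List using (List)
open import Data.List.Membership.Propositional using (_∈_)
open import Data.Product using (Σ; ∃; _×_)
open import Relation.Binary.PropositionalEquality using (_≡_; _≢_)
open import Relation.Nullary.Decidable using (does)
open import Data.Bool using (if_then_else_)

-- Vectors of V_ℤ = ⊕_{s∈S} ℤ α_s, written in the basis of simple roots (S = Fin n).
ZVec : ℕ → Set
ZVec n = Vec ℤ n

simpleRoot : ∀ {n} → Fin n → ZVec n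
simpleRoot i = tabulate λ k → if does (k Fin.≟ i) then + 1 else + 0

sumℤ : ∀ {m} → (Fin m → ℤ) → ℤ
sumℤ {zero}  f = + 0
sumℤ {suc m} f = f zero ℤ.+ sumℤ (λ j → f (suc j))

sumℚ : ∀ {m} → (Fin m → ℚ) → ℚ
sumℚ {zero}  f = 0ℚ
sumℚ {suc m} f = f zero ℚ.+ sumℚ (λ j → f (suc j))

toℚ : ℤ → ℚ
toℚ z = z ℚ./ 1

-- Generalized Cartan matrix (Kac convention: A i j = ⟨α_i^∨ , α_j⟩).
record IsCartanMatrix {n : ℕ} (A : Fin n → Fin n → ℤ) : Set where
  field
    diag    : ∀ i → A i i ≡ + 2
    offDiag : ∀ i j → i ≢ j → A i j ℤ.≤ + 0
    zeroSym : ∀ i j → A i j ≡ + 0 → A j i ≡ + 0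

pairing : ∀ {n} → (Fin n → Fin n → ℤ) → Fin n → ZVec n → ℤ
pairing A i v = sumℤ λ j → A i j ℤ.* lookup v j

reflect : ∀ {n} → (Fin n → Fin n → ℤ) → Fin n → ZVec n → ZVec n
reflect A i v = tabulate λ k →
  lookup v k ℤ.- (if does (k Fin.≟ i) then pairing A i v else + 0)

data IsRoot {n : ℕ} (A : Fin n → Fin n → ℤ) : ZVec n → Set where
  simple : ∀ i → IsRoot A (simpleRoot i)
  refl⟨_⟩ : ∀ i {v} → IsRoot A v → IsRoot A (reflect A i v)

-- Φ is finite (equivalently, W is finite).
FiniteRootSystem : ∀ {n} → (Fin n → Fin n → ℤ) → Set
FiniteRootSystem {n} A = Σ (List (ZVec n)) λ L → ∀ v → IsRoot A v → v ∈ L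

IsPositiveRoot : ∀ {n} → (Fin n → Fin n → ℤ) → ZVec n → Set
IsPositiveRoot A v = IsRoot A v × All (ℤ._≤_ (+ 0)) v

IsBasisℚ : ∀ {n m} → (Fin m → ZVec n) → Set
IsBasisℚ {n} {m} B =
  ((c : Fin m → ℚ) →
     (∀ k → sumℚ (λ j → c j ℚ.* toℚ (lookup (B j) k)) ≡ 0ℚ) →
     ∀ j → c j ≡ 0ℚ)
  ×
  ((v : Fin n → ℚ) → ∃ λ (c : Fin m → ℚ) →
     ∀ k → sumℚ (λ j → c j ℚ.* toℚ (lookup (B j) k)) ≡ v k)

-- ρ^{(p)}(B) is a basis of V^{(p)} = 𝔽_p^n (elements of 𝔽_p represented by
-- integers, equality in 𝔽_p being congruence mod p).
IsBasisMod : ∀ {n m} → ℕ → (Fin m → ZVec n) → Set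
IsBasisMod {n} {m} p B =
  ((c : Fin m → ℤ) →
     (∀ k → (+ p) ∣ℤ sumℤ (λ j → c j ℤ.* lookup (B j) k)) →
     ∀ j → (+ p) ∣ℤ c j)
  ×
  ((v : Fin n → ℤ) → ∃ λ (c : Fin m → ℤ) →
     ∀ k → (+ p) ∣ℤ (sumℤ (λ j → c j ℤ.* lookup (B j) k) ℤ.- v k))

Compatible : ∀ {n} → (Fin n → Fin n → ℤ) → ℕ → Set
Compatible {n} A p =
  ∀ {m} (B : Fin m → ZVec n) →
  (∀ j → IsPositiveRoot A (B j)) →
  IsBasisℚ B → IsBasisMod p B

module Submission where

-- Let B be a ℚ-basis of V consisting of m positive roots, with coordinate matrix b.  The
-- entries of b lie in [0, K] (K = total size of L), and m ≤ |L| because basis vectors are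
-- distinct.  Over ℚ, clearing denominators gives integer rows a_l with a_l·b = Q_l e_l.  A
-- pigeonhole argument on the residues t e_l − ⌊t a_l / Q_l⌋·b, which lie in a box of side
-- M = 1 + |L| K, yields 0 < d ≤ T = (M^n)^n and an integer matrix Z with Z·b = d; since B is
-- independent also b·Z = d.  The threshold T depends on L only, and for every prime p > T
-- the number d is invertible mod p, so B remains a basis mod p.  Euclid's argument supplies
-- primes above N + T for every N.

open import Defs
open import Data.Nat using (ℕ; _<_)
open import Data.Nat.Primality using (Prime)
open import Data.Fin using (Fin)
open import Data.Integer using (ℤ)
open import Data.Product using (∃; _×_)

open import Data.Empty using (⊥-elim)
open import Data.Fin as Fin using (zero; suc)
import Data.Fin.Properties as FinP
open import Data.Integer as ℤ using (+_; -_; _+_; _-_; _*_)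
open import Data.Integer.DivMod using (_/ℕ_; _%ℕ_; a≡a%ℕn+[a/ℕn]*n; n%ℕd<d)
import Data.Integer.Divisibility as ℤD
open import Data.Integer.Divisibility.Signed
  using (_∣_; divides; ∣m∣n⇒∣m+n; ∣m∣n⇒∣m-n; ∣n⇒∣m*n; ∣m⇒∣m*n; ∣⇒∣ᵤ; ∣ᵤ⇒∣)
import Data.Integer.Properties as ℤP
open import Data.Integer.Tactic.RingSolver using (solve-∀)
open import Data.List as List using (List; []; _∷_; length)
open import Data.List.Membership.Propositional using (_∈_)
open import Data.List.Relation.Unary.All using () renaming (_∷_ to _∷ᴬ_)
import Data.List.Relation.Unary.Any as Any
open import Data.List.Relation.Unary.Any using (here; there)
import Data.List.Relation.Unary.Any.Properties as AnyP
import Data.Nat as ℕ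
open import Data.Nat.Coprimality using (prime⇒coprime; coprime-Bézout)
import Data.Nat.Divisibility as ℕD
open import Data.Nat.GCD using (module Bézout)
open import Data.Nat.ListAction using (product)
import Data.Nat.Primality as Primality
open import Data.Nat.Primality.Factorisation using (PrimeFactorisation; factorise)
import Data.Nat.Properties as ℕP
open import Data.Product using (∃₂; _,_; proj₁; proj₂)
open import Data.Rational as ℚ using (ℚ; ↥_; ↧ₙ_; toℚᵘ)
import Data.Rational.Properties as ℚP
open import Data.Rational.Unnormalised as ℚᵘ using (ℚᵘ; mkℚᵘ; *≡*)
import Data.Rational.Unnormalised.Properties as ℚᵘP
open import Data.Vec using (lookup; []; _∷_)
open import Data.Vec.Relation.Unary.All using (All)
import Data.Vec.Relation.Unary.All.Properties as AllP
open import Function using (_∘_)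
open import Relation.Binary.PropositionalEquality
open import Relation.Nullary using (yes; no)

open import Algebra.Properties.Semiring.Sum ℤP.+-*-semiring
  using (sum; sum-cong-≗; ∑-comm; ∑-distrib-+; *-distribˡ-sum; *-distribʳ-sum)
open import Algebra.Properties.Semiring.Sum ℕP.+-*-semiring using () renaming (sum to sumₙ)

-- toℚ : ℤ → ℚ is an injective ring homomorphism; this is checked on the unnormalised
-- fraction z/1, whose normal form is toℚ z.
fraction : ℤ → ℚᵘ
fraction z = mkℚᵘ z 0

toℚᵘ-toℚ : ∀ z → toℚᵘ (toℚ z) ℚᵘ.≃ fraction z
toℚᵘ-toℚ z = ℚP.toℚᵘ-fromℚᵘ (fraction z)

toℚ-+ : ∀ a b → toℚ (a + b) ≡ toℚ a ℚ.+ toℚ b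
toℚ-+ a b = ℚP.toℚᵘ-injective (begin
  toℚᵘ (toℚ (a + b))             ≈⟨ toℚᵘ-toℚ (a + b) ⟩
  fraction (a + b)               ≈⟨ *≡* (fraction-+ a b) ⟩
  fraction a ℚᵘ.+ fraction b     ≈⟨ ℚᵘP.+-cong (toℚᵘ-toℚ a) (toℚᵘ-toℚ b) ⟨
  toℚᵘ (toℚ a) ℚᵘ.+ toℚᵘ (toℚ b) ≈⟨ ℚP.toℚᵘ-homo-+ (toℚ a) (toℚ b) ⟨
  toℚᵘ (toℚ a ℚ.+ toℚ b)         ∎)
  where
  open ℚᵘP.≃-Reasoning
  fraction-+ : ∀ a b → (a + b) * (+ 1 * + 1) ≡ (a * + 1 + b * + 1) * + 1
  fraction-+ = solve-∀

toℚ-* : ∀ a b → toℚ (a * b) ≡ toℚ a ℚ.* toℚ b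
toℚ-* a b = ℚP.toℚᵘ-injective (begin
  toℚᵘ (toℚ (a * b))             ≈⟨ toℚᵘ-toℚ (a * b) ⟩
  fraction (a * b)               ≈⟨ *≡* (fraction-* a b) ⟩
  fraction a ℚᵘ.* fraction b     ≈⟨ ℚᵘP.*-cong (toℚᵘ-toℚ a) (toℚᵘ-toℚ b) ⟨
  toℚᵘ (toℚ a) ℚᵘ.* toℚᵘ (toℚ b) ≈⟨ ℚP.toℚᵘ-homo-* (toℚ a) (toℚ b) ⟨
  toℚᵘ (toℚ a ℚ.* toℚ b)         ∎)
  where
  open ℚᵘP.≃-Reasoning
  fraction-* : ∀ a b → (a * b) * (+ 1 * + 1) ≡ (a * b) * + 1
  fraction-* = solve-∀

toℚ-injective : ∀ {a b} → toℚ a ≡ toℚ b → a ≡ b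
toℚ-injective {a} {b} eq with ℚᵘP.≃-trans (ℚᵘP.≃-sym (toℚᵘ-toℚ a)) (ℚᵘP.≃-trans (ℚP.toℚᵘ-cong eq) (toℚᵘ-toℚ b))
... | *≡* a*1≡b*1 = trans (sym (ℤP.*-identityʳ a)) (trans a*1≡b*1 (ℤP.*-identityʳ b))

numerator≡denominator*q : ∀ q → toℚ (↥ q) ≡ toℚ (+ ↧ₙ q) ℚ.* q
numerator≡denominator*q q@record{} = ℚP.toℚᵘ-injective (begin
  toℚᵘ (toℚ (↥ q))                   ≈⟨ toℚᵘ-toℚ (↥ q) ⟩
  fraction (↥ q)                     ≈⟨ *≡* (cross (↥ q) (+ ↧ₙ q)) ⟩
  fraction (+ ↧ₙ q) ℚᵘ.* toℚᵘ q      ≈⟨ ℚᵘP.*-cong (toℚᵘ-toℚ (+ ↧ₙ q)) ℚᵘP.≃-refl ⟨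
  toℚᵘ (toℚ (+ ↧ₙ q)) ℚᵘ.* toℚᵘ q    ≈⟨ ℚP.toℚᵘ-homo-* (toℚ (+ ↧ₙ q)) q ⟨
  toℚᵘ (toℚ (+ ↧ₙ q) ℚ.* q)          ∎)
  where
  open ℚᵘP.≃-Reasoning
  cross : ∀ n d → n * (+ 1 * d) ≡ (d * n) * + 1
  cross = solve-∀

open ≡-Reasoning

sumℤ≡sum : ∀ {m} (f : Fin m → ℤ) → sumℤ f ≡ sum f
sumℤ≡sum {ℕ.zero}  f = refl
sumℤ≡sum {ℕ.suc m} f = cong (_+_ (f zero)) (sumℤ≡sum (f ∘ suc))

∑-zero : ∀ {m} (f : Fin m → ℤ) → sum (λ j → + 0 * f j) ≡ + 0
∑-zero f = trans (sym (*-distribˡ-sum (+ 0) f)) (ℤP.*-zeroˡ (sum f))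

∑-distrib-- : ∀ {m} (f g : Fin m → ℤ) → sum (λ j → f j - g j) ≡ sum f - sum g
∑-distrib-- f g = begin
  sum (λ j → f j - g j)           ≡⟨ ∑-distrib-+ f (λ j → - g j) ⟩
  sum f + sum (λ j → - g j)       ≡⟨ cong (_+_ (sum f)) (sum-cong-≗ (λ j → sym (ℤP.-1*i≡-i (g j)))) ⟩
  sum f + sum (λ j → ℤ.-1ℤ * g j) ≡⟨ cong (_+_ (sum f)) (sym (*-distribˡ-sum ℤ.-1ℤ g)) ⟩
  sum f + ℤ.-1ℤ * sum g           ≡⟨ cong (_+_ (sum f)) (ℤP.-1*i≡-i (sum g)) ⟩
  sum f - sum g                   ∎

δ : ∀ {m} → Fin m → Fin m → ℤ
δ zero    zero    = + 1
δ zero    (suc j) = + 0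
δ (suc i) zero    = + 0
δ (suc i) (suc j) = δ i j

δ-sym : ∀ {m} (i j : Fin m) → δ i j ≡ δ j i
δ-sym zero    zero    = refl
δ-sym zero    (suc j) = refl
δ-sym (suc i) zero    = refl
δ-sym (suc i) (suc j) = δ-sym i j

δ-diagonal : ∀ {m} (i : Fin m) → δ i i ≡ + 1
δ-diagonal zero    = refl
δ-diagonal (suc i) = δ-diagonal i

δ≡1⇒≡ : ∀ {m} {i j : Fin m} → δ i j ≡ + 1 → i ≡ j
δ≡1⇒≡ {i = zero}  {zero}  _ = refl
δ≡1⇒≡ {i = suc i} {suc j} δij≡1 = cong suc (δ≡1⇒≡ δij≡1)

∑-δˡ : ∀ {m} (i : Fin m) (f : Fin m → ℤ) → sum (λ j → δ i j * f j) ≡ f i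
∑-δˡ zero f = begin
  + 1 * f zero + sum (λ j → + 0 * f (suc j)) ≡⟨ cong₂ _+_ (ℤP.*-identityˡ (f zero)) (∑-zero (f ∘ suc)) ⟩
  f zero + + 0                               ≡⟨ ℤP.+-identityʳ (f zero) ⟩
  f zero                                     ∎
∑-δˡ (suc i) f = begin
  + 0 * f zero + sum (λ j → δ i j * f (suc j)) ≡⟨ cong₂ _+_ (ℤP.*-zeroˡ (f zero)) (∑-δˡ i (f ∘ suc)) ⟩
  + 0 + f (suc i)                              ≡⟨ ℤP.+-identityˡ (f (suc i)) ⟩
  f (suc i)                                    ∎

∑-δʳ : ∀ {m} (i : Fin m) (f : Fin m → ℤ) → sum (λ j → f j * δ j i) ≡ f i
∑-δʳ i f = trans (sum-cong-≗ (λ j → trans (ℤP.*-comm (f j) (δ j i)) (cong (_* f j) (δ-sym j i))))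
                 (∑-δˡ i f)

-- Integer matrices, acting on row vectors from the right.
Matrix : ℕ → ℕ → Set
Matrix r c = Fin r → Fin c → ℤ

infixl 7 _⊙_ _·_

_⊙_ : ∀ {r c} → (Fin r → ℤ) → Matrix r c → Fin c → ℤ
(x ⊙ X) k = sum λ j → x j * X j k

_·_ : ∀ {r s c} → Matrix r s → Matrix s c → Matrix r c
(X · Y) i = X i ⊙ Y

scalar : ∀ {n} → ℤ → Matrix n n
scalar d i k = d * δ i k

⊙-congˡ : ∀ {r c} {x y : Fin r → ℤ} (X : Matrix r c) → (∀ j → x j ≡ y j) → ∀ k → (x ⊙ X) k ≡ (y ⊙ X) k
⊙-congˡ X x≗y k = sum-cong-≗ (λ j → cong (_* X j k) (x≗y j))

⊙-congʳ : ∀ {r c} (x : Fin r → ℤ) {X Y : Matrix r c} → (∀ j k → X j k ≡ Y j k) → ∀ k → (x ⊙ X) k ≡ (x ⊙ Y) k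
⊙-congʳ x X≗Y k = sum-cong-≗ (λ j → cong (x j *_) (X≗Y j k))

⊙-+ : ∀ {r c} (x y : Fin r → ℤ) (X : Matrix r c) k → ((λ j → x j + y j) ⊙ X) k ≡ (x ⊙ X) k + (y ⊙ X) k
⊙-+ x y X k = trans (sum-cong-≗ (λ j → ℤP.*-distribʳ-+ (X j k) (x j) (y j)))
                    (∑-distrib-+ (λ j → x j * X j k) (λ j → y j * X j k))

⊙-- : ∀ {r c} (x y : Fin r → ℤ) (X : Matrix r c) k → ((λ j → x j - y j) ⊙ X) k ≡ (x ⊙ X) k - (y ⊙ X) k
⊙-- x y X k = trans (sum-cong-≗ (λ j → distrib (x j) (y j) (X j k)))
                    (∑-distrib-- (λ j → x j * X j k) (λ j → y j * X j k))
  where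
  distrib : ∀ a b c → (a - b) * c ≡ a * c - b * c
  distrib = solve-∀

⊙-scale : ∀ {r c} (a : ℤ) (x : Fin r → ℤ) (X : Matrix r c) k → ((λ j → a * x j) ⊙ X) k ≡ a * (x ⊙ X) k
⊙-scale a x X k = trans (sum-cong-≗ (λ j → ℤP.*-assoc a (x j) (X j k)))
                        (sym (*-distribˡ-sum a (λ j → x j * X j k)))

⊙-δ : ∀ {r c} (i : Fin r) (X : Matrix r c) k → (δ i ⊙ X) k ≡ X i k
⊙-δ i X k = ∑-δˡ i (λ j → X j k)

⊙-scalar : ∀ {n} (x : Fin n → ℤ) (d : ℤ) k → (x ⊙ scalar d) k ≡ d * x k
⊙-scalar x d k = trans (sum-cong-≗ (λ j → swap (x j) d (δ j k))) (∑-δʳ k (λ j → d * x j))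
  where
  swap : ∀ a b c → a * (b * c) ≡ b * a * c
  swap = solve-∀

⊙-assoc : ∀ {r s c} (x : Fin r → ℤ) (X : Matrix r s) (Y : Matrix s c) k →
          ((x ⊙ X) ⊙ Y) k ≡ (x ⊙ (X · Y)) k
⊙-assoc x X Y k = begin
  sum (λ i → sum (λ j → x j * X j i) * Y i k)  ≡⟨ sum-cong-≗ (λ i → *-distribʳ-sum (Y i k) (λ j → x j * X j i)) ⟩
  sum (λ i → sum (λ j → x j * X j i * Y i k))  ≡⟨ ∑-comm (λ i j → x j * X j i * Y i k) ⟩
  sum (λ j → sum (λ i → x j * X j i * Y i k))  ≡⟨ sum-cong-≗ (λ j → sum-cong-≗ (λ i → ℤP.*-assoc (x j) (X j i) (Y i k))) ⟩
  sum (λ j → sum (λ i → x j * (X j i * Y i k))) ≡⟨ sum-cong-≗ (λ j → sym (*-distribˡ-sum (x j) (λ i → X j i * Y i k))) ⟩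
  sum (λ j → x j * sum (λ i → X j i * Y i k))  ∎

⊙-inverse : ∀ {r s} {X : Matrix r s} {Y : Matrix s r} {d} → (∀ i k → (X · Y) i k ≡ scalar d i k) →
            ∀ x k → ((x ⊙ X) ⊙ Y) k ≡ d * x k
⊙-inverse {X = X} {Y} {d} XY≡d x k =
  trans (⊙-assoc x X Y k) (trans (⊙-congʳ x XY≡d k) (⊙-scalar x d k))

sumℚ-cong : ∀ {m} {f g : Fin m → ℚ} → (∀ j → f j ≡ g j) → sumℚ f ≡ sumℚ g
sumℚ-cong {ℕ.zero}  f≗g = refl
sumℚ-cong {ℕ.suc m} f≗g = cong₂ ℚ._+_ (f≗g zero) (sumℚ-cong (f≗g ∘ suc))

sumℚ-*ˡ : ∀ {m} (c : ℚ) (f : Fin m → ℚ) → sumℚ (λ j → c ℚ.* f j) ≡ c ℚ.* sumℚ f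
sumℚ-*ˡ {ℕ.zero}  c f = sym (ℚP.*-zeroʳ c)
sumℚ-*ˡ {ℕ.suc m} c f = trans (cong (ℚ._+_ (c ℚ.* f zero)) (sumℚ-*ˡ c (f ∘ suc)))
                              (sym (ℚP.*-distribˡ-+ c (f zero) (sumℚ (f ∘ suc))))

toℚ-sumℤ : ∀ {m} (f : Fin m → ℤ) → toℚ (sumℤ f) ≡ sumℚ (toℚ ∘ f)
toℚ-sumℤ {ℕ.zero}  f = refl
toℚ-sumℤ {ℕ.suc m} f = trans (toℚ-+ (f zero) (sumℤ (f ∘ suc))) (cong (ℚ._+_ (toℚ (f zero))) (toℚ-sumℤ (f ∘ suc)))

commonDenominator : ∀ {m} (c : Fin m → ℚ) →
  ∃ λ Q' → ∃ λ (a : Fin m → ℤ) → ∀ j → toℚ (a j) ≡ toℚ (+ ℕ.suc Q') ℚ.* c j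
commonDenominator {ℕ.zero}  c = 0 , (λ ()) , λ ()
commonDenominator {ℕ.suc m} c with commonDenominator (c ∘ suc)
... | Q' , a , a≡Qc = Q″ , a′ , a′≡DQc
  where
  d₀ : ℕ
  d₀ = ℚ.ℚ.denominator-1 (c zero)
  D Q : ℤ
  D = + ↧ₙ c zero
  Q = + ℕ.suc Q'
  -- the new denominator: ℕ.suc Q″ is definitionally ↧ₙ (c zero) ℕ.* ℕ.suc Q'
  Q″ : ℕ
  Q″ = Q' ℕ.+ d₀ ℕ.* ℕ.suc Q'
  DQ≡D*Q : toℚ (+ ℕ.suc Q″) ≡ toℚ D ℚ.* toℚ Q
  DQ≡D*Q = trans (cong toℚ (ℤP.pos-* (ℕ.suc d₀) (ℕ.suc Q'))) (toℚ-* D Q)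
  a′ : Fin (ℕ.suc m) → ℤ
  a′ zero    = ↥ c zero * Q
  a′ (suc j) = D * a j
  a′≡DQc : ∀ j → toℚ (a′ j) ≡ toℚ (+ ℕ.suc Q″) ℚ.* c j
  a′≡DQc zero = begin
    toℚ (↥ c zero * Q)                 ≡⟨ toℚ-* (↥ c zero) Q ⟩
    toℚ (↥ c zero) ℚ.* toℚ Q           ≡⟨ cong (ℚ._* toℚ Q) (numerator≡denominator*q (c zero)) ⟩
    toℚ D ℚ.* c zero ℚ.* toℚ Q         ≡⟨ ℚP.*-assoc (toℚ D) (c zero) (toℚ Q) ⟩
    toℚ D ℚ.* (c zero ℚ.* toℚ Q)       ≡⟨ cong (toℚ D ℚ.*_) (ℚP.*-comm (c zero) (toℚ Q)) ⟩
    toℚ D ℚ.* (toℚ Q ℚ.* c zero)       ≡⟨ ℚP.*-assoc (toℚ D) (toℚ Q) (c zero) ⟨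
    toℚ D ℚ.* toℚ Q ℚ.* c zero         ≡⟨ cong (ℚ._* c zero) DQ≡D*Q ⟨
    toℚ (+ ℕ.suc Q″) ℚ.* c zero        ∎
  a′≡DQc (suc j) = begin
    toℚ (D * a j)                      ≡⟨ toℚ-* D (a j) ⟩
    toℚ D ℚ.* toℚ (a j)                ≡⟨ cong (toℚ D ℚ.*_) (a≡Qc j) ⟩
    toℚ D ℚ.* (toℚ Q ℚ.* c (suc j))    ≡⟨ ℚP.*-assoc (toℚ D) (toℚ Q) (c (suc j)) ⟨
    toℚ D ℚ.* toℚ Q ℚ.* c (suc j)      ≡⟨ cong (ℚ._* c (suc j)) DQ≡D*Q ⟨
    toℚ (+ ℕ.suc Q″) ℚ.* c (suc j)     ∎

coordinates : ∀ {m n} → (Fin m → ZVec n) → Matrix m n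
coordinates B j k = lookup (B j) k

toℚ-⊙ : ∀ {r c} (x : Fin r → ℤ) (X : Matrix r c) k →
        toℚ ((x ⊙ X) k) ≡ sumℚ (λ j → toℚ (x j) ℚ.* toℚ (X j k))
toℚ-⊙ x X k = begin
  toℚ (sum (λ j → x j * X j k))            ≡⟨ cong toℚ (sumℤ≡sum (λ j → x j * X j k)) ⟨
  toℚ (sumℤ (λ j → x j * X j k))           ≡⟨ toℚ-sumℤ (λ j → x j * X j k) ⟩
  sumℚ (λ j → toℚ (x j * X j k))           ≡⟨ sumℚ-cong (λ j → toℚ-* (x j) (X j k)) ⟩
  sumℚ (λ j → toℚ (x j) ℚ.* toℚ (X j k))   ∎

module _ {m n} (B : Fin m → ZVec n) (basis : IsBasisℚ B) where

  private
    b : Matrix m n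
    b = coordinates B

  integerIndependence : (x : Fin m → ℤ) → (∀ k → (x ⊙ coordinates B) k ≡ + 0) → ∀ j → x j ≡ + 0
  integerIndependence x x⊙b≡0 =
    toℚ-injective ∘ proj₁ basis (toℚ ∘ x) (λ k → trans (sym (toℚ-⊙ x b k)) (cong toℚ (x⊙b≡0 k)))

  integerSpan : ∀ l → ∃ λ Q' → ∃ λ (a : Fin m → ℤ) →
                ∀ k → (a ⊙ coordinates B) k ≡ + ℕ.suc Q' * δ l k
  integerSpan l with proj₂ basis (toℚ ∘ δ l)
  ... | c , c⊙b≡δ with commonDenominator c
  ... | Q' , a , a≡Qc = Q' , a , λ k → toℚ-injective (begin
    toℚ ((a ⊙ b) k)                                  ≡⟨ toℚ-⊙ a b k ⟩
    sumℚ (λ j → toℚ (a j) ℚ.* toℚ (b j k))            ≡⟨ sumℚ-cong (λ j → cong (ℚ._* toℚ (b j k)) (a≡Qc j)) ⟩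
    sumℚ (λ j → toℚ Q ℚ.* c j ℚ.* toℚ (b j k))        ≡⟨ sumℚ-cong (λ j → ℚP.*-assoc (toℚ Q) (c j) (toℚ (b j k))) ⟩
    sumℚ (λ j → toℚ Q ℚ.* (c j ℚ.* toℚ (b j k)))      ≡⟨ sumℚ-*ˡ (toℚ Q) (λ j → c j ℚ.* toℚ (b j k)) ⟩
    toℚ Q ℚ.* sumℚ (λ j → c j ℚ.* toℚ (b j k))        ≡⟨ cong (toℚ Q ℚ.*_) (c⊙b≡δ k) ⟩
    toℚ Q ℚ.* toℚ (δ l k)                             ≡⟨ toℚ-* Q (δ l k) ⟨
    toℚ (Q * δ l k)                                   ∎)
    where
    Q : ℤ
    Q = + ℕ.suc Q'

  -- A left inverse up to the scalar d is also a right inverse up to d: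
  -- (B Z − d)·B = B (Z B) − d B = 0, so B Z − d vanishes by independence.
  rightInverse : ∀ {Z : Matrix n m} {d} →
    (∀ l k → (Z · coordinates B) l k ≡ scalar d l k) → ∀ j i → (coordinates B · Z) j i ≡ scalar d j i
  rightInverse {Z} {d} Zb≡d j i = ℤP.i-j≡0⇒i≡j _ _ (integerIndependence x x⊙b≡0 i)
    where
    x : Fin m → ℤ
    x i = (b · Z) j i - scalar d j i
    x⊙b≡0 : ∀ k → (x ⊙ b) k ≡ + 0
    x⊙b≡0 k = begin
      (x ⊙ b) k                                         ≡⟨ ⊙-- (λ i → (b · Z) j i) (λ i → d * δ j i) b k ⟩
      ((b j ⊙ Z) ⊙ b) k - ((λ i → d * δ j i) ⊙ b) k     ≡⟨ cong₂ _-_ (⊙-inverse {X = Z} {b} {d} Zb≡d (b j) k) (⊙-scale d (δ j) b k) ⟩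
      d * b j k - d * (δ j ⊙ b) k                       ≡⟨ cong (λ e → d * b j k - d * e) (⊙-δ j b k) ⟩
      d * b j k - d * b j k                             ≡⟨ ℤP.+-inverseʳ (d * b j k) ⟩
      + 0                                               ∎

EntriesBelow : ∀ {r c} → ℕ → Matrix r c → Set
EntriesBelow K X = ∀ i k → ∃ λ β → X i k ≡ + β × β ℕ.≤ K

∑-pos : ∀ {m} (f : Fin m → ℕ) → sum (λ j → + f j) ≡ + sumₙ f
∑-pos {ℕ.zero}  f = refl
∑-pos {ℕ.suc m} f = trans (cong (_+_ (+ f zero)) (∑-pos (f ∘ suc))) (sym (ℤP.pos-+ (f zero) (sumₙ (f ∘ suc))))

sumₙ-≤ : ∀ {m} (f : Fin m → ℕ) {X} → (∀ j → f j ℕ.≤ X) → sumₙ f ℕ.≤ m ℕ.* X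
sumₙ-≤ {ℕ.zero}  f f≤X = ℕ.z≤n
sumₙ-≤ {ℕ.suc m} f f≤X = ℕP.+-mono-≤ (f≤X zero) (sumₙ-≤ (f ∘ suc) (f≤X ∘ suc))

quotient-bound : ∀ {Q' M S} (w : ℤ) → + ℕ.suc Q' * w ≡ + S → S < ℕ.suc Q' ℕ.* M → ∃ λ y → w ≡ + y × y < M
quotient-bound {Q'} {M} (+ y) Qy≡S S<QM = y , refl ,
  ℕP.*-cancelˡ-< (ℕ.suc Q') y M (subst (_< ℕ.suc Q' ℕ.* M) (sym (ℤP.+-injective (trans (ℤP.pos-* (ℕ.suc Q') y) Qy≡S))) S<QM)
quotient-bound ℤ.-[1+ y ] () S<QM

-- For t ∈ ℕ divide t·a by Q coordinatewise:
-- t a_j = Q q_j + r_j with 0 ≤ r_j < Q.  The residue t e_l − q·b equals (r·b)/Q, so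
-- when b has entries in [0, K] and m K < M, every residue lies in the box [0, M)^n.
module Residues {m n} (b : Matrix m n) {K M : ℕ} (bounded : EntriesBelow K b) (mK<M : m ℕ.* K < M)
                (l : Fin n) (Q' : ℕ) (a : Fin m → ℤ) (a⊙b≡Qδ : ∀ k → (a ⊙ b) k ≡ + ℕ.suc Q' * δ l k) where

  Q : ℤ
  Q = + ℕ.suc Q'

  quotient : ℕ → Fin m → ℤ
  quotient t j = (+ t * a j) /ℕ ℕ.suc Q'

  remainder : ℕ → Fin m → ℕ
  remainder t j = (+ t * a j) %ℕ ℕ.suc Q'

  residue : ℕ → Fin n → ℤ
  residue t k = + t * δ l k - (quotient t ⊙ b) k

  Q*residue : ∀ t k → Q * residue t k ≡ ((λ j → + remainder t j) ⊙ b) k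
  Q*residue t k = begin
    Q * (+ t * δ l k - (q ⊙ b) k)                   ≡⟨ expand (+ t) Q (δ l k) ((q ⊙ b) k) ⟩
    + t * (Q * δ l k) - Q * (q ⊙ b) k               ≡⟨ cong (λ e → + t * e - Q * (q ⊙ b) k) (a⊙b≡Qδ k) ⟨
    + t * (a ⊙ b) k - Q * (q ⊙ b) k                 ≡⟨ cong₂ _-_ (⊙-scale (+ t) a b k) (⊙-scale Q q b k) ⟨
    (ta ⊙ b) k - (Qq ⊙ b) k                         ≡⟨ cong (_- (Qq ⊙ b) k) (⊙-congˡ b division k) ⟩
    ((λ j → r j + Qq j) ⊙ b) k - (Qq ⊙ b) k         ≡⟨ cong (_- (Qq ⊙ b) k) (⊙-+ r Qq b k) ⟩
    (r ⊙ b) k + (Qq ⊙ b) k - (Qq ⊙ b) k             ≡⟨ cancel ((r ⊙ b) k) ((Qq ⊙ b) k) ⟩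
    (r ⊙ b) k                                       ∎
    where
    q r ta Qq : Fin m → ℤ
    q = quotient t
    r j = + remainder t j
    ta j = + t * a j
    Qq j = Q * q j
    division : ∀ j → ta j ≡ r j + Qq j
    division j = trans (a≡a%ℕn+[a/ℕn]*n (ta j) (ℕ.suc Q')) (cong (_+_ (r j)) (ℤP.*-comm (q j) Q))
    expand : ∀ t Q e s → Q * (t * e - s) ≡ t * (Q * e) - Q * s
    expand = solve-∀
    cancel : ∀ x y → x + y - y ≡ x
    cancel = solve-∀

  quotient⊙b : ∀ t k → (quotient t ⊙ b) k ≡ + t * δ l k - residue t k
  quotient⊙b t k = undo (+ t * δ l k) ((quotient t ⊙ b) k)
    where
    undo : ∀ x y → y ≡ x - (x - y)
    undo = solve-∀

  residue-bounded : ∀ t k → ∃ λ y → residue t k ≡ + y × y < M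
  residue-bounded t k = quotient-bound {Q'} (residue t k) Q*w≡S S<QM
    where
    β : Fin m → ℕ
    β j = proj₁ (bounded j k)
    S : ℕ
    S = sumₙ (λ j → remainder t j ℕ.* β j)
    Q*w≡S : Q * residue t k ≡ + S
    Q*w≡S = trans (Q*residue t k) (trans
      (sum-cong-≗ (λ j → trans (cong (_*_ (+ remainder t j)) (proj₁ (proj₂ (bounded j k))))
                                (sym (ℤP.pos-* (remainder t j) (β j)))))
      (∑-pos (λ j → remainder t j ℕ.* β j)))
    S<QM : S < ℕ.suc Q' ℕ.* M
    S<QM = ℕP.≤-<-trans (sumₙ-≤ (λ j → remainder t j ℕ.* β j)
                          (λ j → ℕP.*-mono-≤ (ℕP.<⇒≤ (n%ℕd<d (+ t * a j) (ℕ.suc Q'))) (proj₂ (proj₂ (bounded j k)))))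
           (subst (_< ℕ.suc Q' ℕ.* M) (swap (ℕ.suc Q') m K) (ℕP.*-monoʳ-< (ℕ.suc Q') mK<M))
      where
      swap : ∀ x y z → x ℕ.* (y ℕ.* z) ≡ y ℕ.* (x ℕ.* z)
      swap x y z = trans (sym (ℕP.*-assoc x y z)) (trans (cong (ℕ._* z) (ℕP.*-comm x y)) (ℕP.*-assoc y x z))

encode : ∀ {M a} → (Fin a → Fin M) → Fin (M ℕ.^ a)
encode {a = ℕ.zero}  f = zero
encode {a = ℕ.suc a} f = Fin.combine (f zero) (encode (f ∘ suc))

encode-injective : ∀ {M a} (f g : Fin a → Fin M) → encode f ≡ encode g → ∀ i → f i ≡ g i
encode-injective {a = ℕ.suc a} f g eq zero    = proj₁ (FinP.combine-injective (f zero) _ (g zero) _ eq)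
encode-injective {a = ℕ.suc a} f g eq (suc i) =
  encode-injective (f ∘ suc) (g ∘ suc) (proj₂ (FinP.combine-injective (f zero) _ (g zero) _ eq)) i

record ScaledLeftInverse {m n} (b : Matrix m n) (bound : ℕ) : Set where
  field
    d    : ℕ
    0<d  : 0 < d
    d≤bound : d ℕ.≤ bound
    Z    : Matrix n m
    Zb≡d : ∀ l k → (Z · b) l k ≡ scalar (+ d) l k

-- The residues of t e_1, …, t e_n for t = 0, …, T, where T = (M^n)^n,
-- lie in a box with T points, so two times t₁ < t₂ give the same residues.  Then d = t₂ − t₁
-- and the rows Z_l = q_l(t₂) − q_l(t₁) satisfy Z·b = d.  The bound T involves only n and M.
scaledLeftInverse : ∀ {m n} (b : Matrix m n) {K M} → EntriesBelow K b → m ℕ.* K < M →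
  (∀ l → ∃ λ Q' → ∃ λ (a : Fin m → ℤ) → ∀ k → (a ⊙ b) k ≡ + ℕ.suc Q' * δ l k) →
  ScaledLeftInverse b ((M ℕ.^ n) ℕ.^ n)
scaledLeftInverse {m} {n} b {K} {M} bounded mK<M span =
  record { d = d ; 0<d = 0<d ; d≤bound = d≤T ; Z = Z ; Zb≡d = Zb≡d }
  where
  module R l = Residues b bounded mK<M l (proj₁ (span l)) (proj₁ (proj₂ (span l))) (proj₂ (proj₂ (span l)))

  T : ℕ
  T = (M ℕ.^ n) ℕ.^ n

  box : ℕ → Fin n → Fin n → Fin M
  box t l k = Fin.fromℕ< (proj₂ (proj₂ (R.residue-bounded l t k)))

  code : Fin (ℕ.suc T) → Fin T
  code i = encode (λ l → encode (box (Fin.toℕ i) l))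

  collision : ∃₂ λ i j → i Fin.< j × code i ≡ code j
  collision = FinP.pigeonhole (ℕP.n<1+n T) code

  i₁ i₂ : Fin (ℕ.suc T)
  i₁ = proj₁ collision
  i₂ = proj₁ (proj₂ collision)

  t₁ t₂ : ℕ
  t₁ = Fin.toℕ i₁
  t₂ = Fin.toℕ i₂

  t₁<t₂ : t₁ < t₂
  t₁<t₂ = proj₁ (proj₂ (proj₂ collision))

  same-residue : ∀ l k → R.residue l t₁ k ≡ R.residue l t₂ k
  same-residue l k = trans (proj₁ (proj₂ bound₁)) (trans (cong +_ same-y) (sym (proj₁ (proj₂ bound₂))))
    where
    bound₁ : ∃ λ y → R.residue l t₁ k ≡ + y × y < M
    bound₁ = R.residue-bounded l t₁ k
    bound₂ : ∃ λ y → R.residue l t₂ k ≡ + y × y < M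
    bound₂ = R.residue-bounded l t₂ k
    same-box : box t₁ l k ≡ box t₂ l k
    same-box = encode-injective (box t₁ l) (box t₂ l)
                 (encode-injective _ _ (proj₂ (proj₂ (proj₂ collision))) l) k
    same-y : proj₁ bound₁ ≡ proj₁ bound₂
    same-y = FinP.fromℕ<-injective _ _ (proj₂ (proj₂ bound₁)) (proj₂ (proj₂ bound₂)) same-box

  d : ℕ
  d = t₂ ℕ.∸ t₁

  0<d : 0 < d
  0<d = ℕP.m<n⇒0<n∸m t₁<t₂

  d≤T : d ℕ.≤ T
  d≤T = ℕP.≤-trans (ℕP.m∸n≤m t₂ t₁) (ℕP.<⇒≤pred (FinP.toℕ<n i₂))

  Z : Matrix n m
  Z l j = R.quotient l t₂ j - R.quotient l t₁ j

  Zb≡d : ∀ l k → (Z · b) l k ≡ scalar (+ d) l k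
  Zb≡d l k = begin
    (Z l ⊙ b) k                                          ≡⟨ ⊙-- (R.quotient l t₂) (R.quotient l t₁) b k ⟩
    (R.quotient l t₂ ⊙ b) k - (R.quotient l t₁ ⊙ b) k    ≡⟨ cong₂ _-_ (R.quotient⊙b l t₂ k) (R.quotient⊙b l t₁ k) ⟩
    (+ t₂ * δ l k - w₂) - (+ t₁ * δ l k - w₁)           ≡⟨ cong (λ w → (+ t₂ * δ l k - w₂) - (+ t₁ * δ l k - w)) (same-residue l k) ⟩
    (+ t₂ * δ l k - w₂) - (+ t₁ * δ l k - w₂)           ≡⟨ difference (+ t₂) (+ t₁) (δ l k) w₂ ⟩
    (+ t₂ - + t₁) * δ l k                               ≡⟨ cong (_* δ l k) (trans (ℤP.m-n≡m⊖n t₂ t₁) (ℤP.⊖-≥ (ℕP.<⇒≤ t₁<t₂))) ⟩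
    + d * δ l k                                         ∎
    where
    w₁ w₂ : ℤ
    w₁ = R.residue l t₁ k
    w₂ = R.residue l t₂ k
    difference : ∀ x y e w → (x * e - w) - (y * e - w) ≡ (x - y) * e
    difference = solve-∀

∑-∣ : ∀ {m} {p} (f : Fin m → ℤ) → (∀ j → p ∣ f j) → p ∣ sum f
∑-∣ {ℕ.zero}  f p∣f = divides (+ 0) refl
∑-∣ {ℕ.suc m} f p∣f = ∣m∣n⇒∣m+n (p∣f zero) (∑-∣ (f ∘ suc) (p∣f ∘ suc))

inverseModPrime : ∀ {p d} → Prime p → 0 < d → d < p → ∃ λ u → + p ∣ u * + d - + 1
inverseModPrime {p} {d} p-prime 0<d d<p with coprime-Bézout (prime⇒coprime p-prime {{ℕ.>-nonZero 0<d}} d<p)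
... | Bézout.+- x y 1+yd≡xp = - + y , divides (- + x) (begin
  - + y * + d - + 1           ≡⟨ negate (+ y) (+ d) ⟩
  - (+ 1 + + y * + d)         ≡⟨ cong (λ z → - (+ 1 + z)) (ℤP.pos-* y d) ⟨
  - (+ 1 + + (y ℕ.* d))       ≡⟨ cong -_ (ℤP.pos-+ 1 (y ℕ.* d)) ⟨
  - + (1 ℕ.+ y ℕ.* d)         ≡⟨ cong (-_ ∘ +_) 1+yd≡xp ⟩
  - + (x ℕ.* p)               ≡⟨ cong -_ (ℤP.pos-* x p) ⟩
  - (+ x * + p)               ≡⟨ ℤP.neg-distribˡ-* (+ x) (+ p) ⟩
  - + x * + p                 ∎)
  where
  negate : ∀ y d → - y * d - + 1 ≡ - (+ 1 + y * d)
  negate = solve-∀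
... | Bézout.-+ x y 1+xp≡yd = + y , divides (+ x) (begin
  + y * + d - + 1             ≡⟨ cong (_- + 1) (ℤP.pos-* y d) ⟨
  + (y ℕ.* d) - + 1           ≡⟨ cong (λ z → + z - + 1) 1+xp≡yd ⟨
  + (1 ℕ.+ x ℕ.* p) - + 1     ≡⟨ cong (_- + 1) (ℤP.pos-+ 1 (x ℕ.* p)) ⟩
  + 1 + + (x ℕ.* p) - + 1     ≡⟨ cancel (+ (x ℕ.* p)) ⟩
  + (x ℕ.* p)                 ≡⟨ ℤP.pos-* x p ⟩
  + x * + p                   ∎)
  where
  cancel : ∀ z → + 1 + z - + 1 ≡ z
  cancel = solve-∀

-- Reduction modulo p.  If Z·B = d and B·Z = d over ℤ with 0 < d < p and p prime, then
-- u Z, where u d ≡ 1 (mod p), is a two-sided inverse of B modulo p, so B stays a basis.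
basisModPrime : ∀ {m n} (B : Fin m → ZVec n) (Z : Matrix n m) {d p} → Prime p → 0 < d → d < p →
  (∀ l k → (Z · coordinates B) l k ≡ scalar (+ d) l k) →
  (∀ j i → (coordinates B · Z) j i ≡ scalar (+ d) j i) → IsBasisMod p B
basisModPrime {m} {n} B Z {d} {p} p-prime 0<d d<p Zb≡d bZ≡d = independent , spanning
  where
  b : Matrix m n
  b = coordinates B

  u : ℤ
  u = proj₁ (inverseModPrime p-prime 0<d d<p)

  p∣ud-1 : + p ∣ u * + d - + 1
  p∣ud-1 = proj₂ (inverseModPrime p-prime 0<d d<p)

  -- c·B ≡ 0 gives d c = (c·B)·Z ≡ 0, hence c = u (d c) − c (u d − 1) ≡ 0.
  independent : (c : Fin m → ℤ) → (∀ k → + p ℤD.∣ sumℤ (λ j → c j * lookup (B j) k)) → ∀ j → + p ℤD.∣ c j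
  independent c p∣c⊙b i =
    ∣⇒∣ᵤ (subst (+ p ∣_) (sym (recover (c i) u (+ d))) (∣m∣n⇒∣m-n (∣n⇒∣m*n u p∣dc) (∣n⇒∣m*n (c i) p∣ud-1)))
    where
    p∣cb : ∀ k → + p ∣ (c ⊙ b) k
    p∣cb k = ∣ᵤ⇒∣ (subst (+ p ℤD.∣_) (sumℤ≡sum (λ j → c j * b j k)) (p∣c⊙b k))
    p∣dc : + p ∣ + d * c i
    p∣dc = subst (+ p ∣_) (⊙-inverse {X = b} {Z} {+ d} bZ≡d c i)
             (∑-∣ (λ k → (c ⊙ b) k * Z k i) (λ k → ∣m⇒∣m*n {m = (c ⊙ b) k} (Z k i) (p∣cb k)))
    recover : ∀ c u d → c ≡ u * (d * c) - c * (u * d - + 1)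
    recover = solve-∀

  -- v ≡ (u v·Z)·B, since (u v·Z)·B = d u v.
  spanning : (v : Fin n → ℤ) → ∃ λ (c : Fin m → ℤ) → ∀ k → + p ℤD.∣ (sumℤ (λ j → c j * lookup (B j) k) - v k)
  spanning v = uv ⊙ Z , λ k → ∣⇒∣ᵤ (subst (+ p ∣_) (sym (error k)) (∣n⇒∣m*n (v k) p∣ud-1))
    where
    uv : Fin n → ℤ
    uv l = u * v l
    error : ∀ k → sumℤ (λ j → (uv ⊙ Z) j * b j k) - v k ≡ v k * (u * + d - + 1)
    error k = begin
      sumℤ (λ j → (uv ⊙ Z) j * b j k) - v k    ≡⟨ cong (_- v k) (sumℤ≡sum (λ j → (uv ⊙ Z) j * b j k)) ⟩
      ((uv ⊙ Z) ⊙ b) k - v k                   ≡⟨ cong (_- v k) (⊙-inverse {X = Z} {b} {+ d} Zb≡d uv k) ⟩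
      + d * (u * v k) - v k                    ≡⟨ factor (+ d) u (v k) ⟩
      v k * (u * + d - + 1)                    ∎
      where
      factor : ∀ d u v → d * (u * v) - v ≡ v * (u * d - + 1)
      factor = solve-∀

n∣n! : ∀ n .{{_ : ℕ.NonZero n}} → n ℕD.∣ n ℕ.!
n∣n! (ℕ.suc n) = ℕD.m∣m*n (n ℕ.!)

-- Euclid: every prime factor of X! + 1 exceeds X.
primeAbove : ∀ X → ∃ λ p → X < p × Prime p
primeAbove X = primeFactor (factorise (ℕ.suc (X ℕ.!)))
  where
  primeFactor : PrimeFactorisation (ℕ.suc (X ℕ.!)) → ∃ λ p → X < p × Prime p
  primeFactor record { factors = [] ; isFactorisation = X!+1≡1 } =
    ⊥-elim (ℕP.<⇒≢ (ℕP.1≤n! X) (sym (ℕP.suc-injective X!+1≡1)))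
  primeFactor record { factors = q ∷ qs ; isFactorisation = X!+1≡q*qs ; factorsPrime = q-prime ∷ᴬ _ }
    with X ℕ.<? q
  ... | yes X<q = q , X<q , q-prime
  ... | no X≮q = ⊥-elim (Primality.¬prime[1] (subst Prime q≡1 q-prime))
    where
    q∣X!+1 : q ℕD.∣ X ℕ.! ℕ.+ 1
    q∣X!+1 = subst (q ℕD.∣_) (trans (sym X!+1≡q*qs) (ℕP.+-comm 1 (X ℕ.!))) (ℕD.m∣m*n (product qs))
    q∣X! : q ℕD.∣ X ℕ.!
    q∣X! = ℕD.∣-trans (n∣n! q {{Primality.prime⇒nonZero q-prime}}) (ℕD.m≤n⇒m!∣n! (ℕP.≮⇒≥ X≮q))
    q≡1 : q ≡ 1
    q≡1 = ℕD.∣1⇒≡1 (ℕD.∣m+n∣m⇒∣n q∣X!+1 q∣X!)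

size : ∀ {n} → ZVec n → ℕ
size []      = 0
size (x ∷ v) = ℤ.∣ x ∣ ℕ.+ size v

coordinate≤size : ∀ {n} (v : ZVec n) k → ℤ.∣ lookup v k ∣ ℕ.≤ size v
coordinate≤size (x ∷ v) zero    = ℕP.m≤m+n ℤ.∣ x ∣ (size v)
coordinate≤size (x ∷ v) (suc k) = ℕP.≤-trans (coordinate≤size v k) (ℕP.m≤n+m (size v) ℤ.∣ x ∣)

totalSize : ∀ {n} → List (ZVec n) → ℕ
totalSize []      = 0
totalSize (v ∷ L) = size v ℕ.+ totalSize L

member≤totalSize : ∀ {n} {v : ZVec n} {L} → v ∈ L → size v ℕ.≤ totalSize L
member≤totalSize {L = v ∷ L} (here refl)  = ℕP.m≤m+n (size v) (totalSize L)
member≤totalSize {L = w ∷ L} (there v∈L) = ℕP.≤-trans (member≤totalSize v∈L) (ℕP.m≤n+m (totalSize L) (size w))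

nonnegativeMembers-bounded : ∀ {m n} {L : List (ZVec n)} (B : Fin m → ZVec n) →
  (∀ j → B j ∈ L) → (∀ j → All (+ 0 ℤ.≤_) (B j)) → EntriesBelow (totalSize L) (coordinates B)
nonnegativeMembers-bounded B members nonneg j k =
  ℤ.∣ lookup (B j) k ∣ ,
  sym (ℤP.0≤i⇒+∣i∣≡i (AllP.lookup⁺ (nonneg j) k)) ,
  ℕP.≤-trans (coordinate≤size (B j) k) (member≤totalSize (members j))

-- The members of a ℚ-basis are distinct, so a basis drawn from L has at most length L members.
basis≤length : ∀ {m n} {L : List (ZVec n)} (B : Fin m → ZVec n) →
  IsBasisℚ B → (∀ j → B j ∈ L) → m ℕ.≤ length L
basis≤length {m} {n} {L} B basis members = FinP.injective⇒≤ index-injective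
  where
  index : Fin m → Fin (length L)
  index j = Any.index (members j)

  index-injective : ∀ {i j} → index i ≡ index j → i ≡ j
  index-injective {i} {j} same-index = sym (δ≡1⇒≡ δji≡1)
    where
    Bi≡Bj : B i ≡ B j
    Bi≡Bj = trans (AnyP.lookup-index (members i))
                  (trans (cong (List.lookup L) same-index) (sym (AnyP.lookup-index (members j))))
    x : Fin m → ℤ
    x t = δ i t - δ j t
    x⊙b≡0 : ∀ k → (x ⊙ coordinates B) k ≡ + 0
    x⊙b≡0 k = begin
      (x ⊙ coordinates B) k                                   ≡⟨ ⊙-- (δ i) (δ j) (coordinates B) k ⟩
      (δ i ⊙ coordinates B) k - (δ j ⊙ coordinates B) k       ≡⟨ cong₂ _-_ (⊙-δ i (coordinates B) k) (⊙-δ j (coordinates B) k) ⟩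
      lookup (B i) k - lookup (B j) k                         ≡⟨ cong (λ v → lookup (B i) k - lookup v k) Bi≡Bj ⟨
      lookup (B i) k - lookup (B i) k                         ≡⟨ ℤP.+-inverseʳ (lookup (B i) k) ⟩
      + 0                                                     ∎
    δji≡1 : δ j i ≡ + 1
    δji≡1 = trans (sym (ℤP.i-j≡0⇒i≡j (δ i i) (δ j i) (integerIndependence B basis x x⊙b≡0 i))) (δ-diagonal i)

threshold : ∀ n → List (ZVec n) → ℕ
threshold n L = (ℕ.suc (length L ℕ.* totalSize L) ℕ.^ n) ℕ.^ n

basisModLargePrime : ∀ {m n} (L : List (ZVec n)) (B : Fin m → ZVec n) →
  (∀ j → B j ∈ L) → (∀ j → All (+ 0 ℤ.≤_) (B j)) → IsBasisℚ B →
  ∀ {p} → Prime p → threshold n L < p → IsBasisMod p B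
basisModLargePrime {m} L B members nonneg basis p-prime T<p =
  basisModPrime B Z p-prime 0<d (ℕP.≤-<-trans d≤bound T<p) Zb≡d (rightInverse B basis {Z} {+ d} Zb≡d)
  where
  mK<M : m ℕ.* totalSize L < ℕ.suc (length L ℕ.* totalSize L)
  mK<M = ℕ.s≤s (ℕP.*-monoˡ-≤ (totalSize L) (basis≤length B basis members))
  open ScaledLeftInverse
    (scaledLeftInverse (coordinates B) (nonnegativeMembers-bounded B members nonneg) mK<M (integerSpan B basis))

mainTheorem16 : (n : ℕ) (A : Fin n → Fin n → ℤ) →
    IsCartanMatrix A → FiniteRootSystem A →
    (N : ℕ) → ∃ λ p → N < p × Prime p × Compatible A p
mainTheorem16 n A _ (L , complete) N with primeAbove (N ℕ.+ threshold n L)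
... | p , N+T<p , p-prime = p , N<p , p-prime , compatible
  where
  N<p : N < p
  N<p = ℕP.≤-<-trans (ℕP.m≤m+n N (threshold n L)) N+T<p
  T<p : threshold n L < p
  T<p = ℕP.≤-<-trans (ℕP.m≤n+m (threshold n L) N) N+T<p
  compatible : Compatible A p
  compatible B positive basis =
    basisModLargePrime L B (λ j → complete (B j) (proj₁ (positive j))) (proj₂ ∘ positive) basis p-prime T<p
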